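{- Let $R$ be a Dedekind domain and let $I$ be a nonzero ideal of $R$ such that $R/I$ is finite and nontrivial. If $I$ is a prime ideal, then $\gamma_{cl}(G_{R/I})=1$. If $I$ is not prime and $Q(I)>\lambda(I)$, then $\gamma_{cl}(G_{R/I})=\lambda(I)+1$. If $I$ is not prime and $Q(I)\le\lambda(I)$, then $\gamma_{cl}(G_{R/I})$ does not exist (no clique of $G_{R/I}$ dominates $G_{R/I}$). Furthermore, if $\gamma_{cl}(G_{R/I})$ exists, then every clique of $G_{R/I}$ of order $\gamma_{cl}(G_{R/I})$ dominates $G_{R/I}$.
   Context: $G_{R/I}$ is the unitary Cayley graph of $R/I$: vertex set $R/I$, with $a+I$, $b+I$ adjacent iff $a-b+I$ is a unit of $R/I$. $Q(I)$ is the minimum of $|R/P|$ over all prime ideals $P$ dividing $I$, and $\lambda(I)$ is the number of distinct prime ideal divisors of $I$. A set $D$ of vertices dominates $G$ if every vertex is in $D$ or adjacent to some element of $D$. The clique domination number $\gamma_{cl}(G)$ is the smallest order of a clique of $G$ that dominates $G$, if some dominating clique exists. -}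

module Defs where

open import Level using (Level; _⊔_; suc)
open import Algebra.Bundles using (CommutativeRing)
open import Data.Nat using (ℕ; zero; _≤_; _<_) renaming (suc to sucℕ)
open import Data.List using (List; []; _∷_; length)
open import Data.List.Relation.Unary.Any using (Any)
open import Data.List.Relation.Unary.All using (All)
open import Data.List.Relation.Unary.AllPairs using (AllPairs)
open import Data.Product using (Σ; ∃; _×_; _,_)
open import Data.Sum using (_⊎_)
open import Relation.Nullary using (¬_)
open import Relation.Binary.PropositionalEquality using (_≡_)

module RingTheory {c ℓ : Level} (R : CommutativeRing c ℓ) where
  open CommutativeRing R

  record Ideal : Set (suc (c ⊔ ℓ)) where
    field
      mem      : Carrier → Set (c ⊔ ℓ)
      resp     : ∀ {x y} → x ≈ y → mem x → mem y
      zero-mem : mem 0#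
      +-mem    : ∀ {x y} → mem x → mem y → mem (x + y)
      *-mem    : ∀ r {x} → mem x → mem (r * x)
  open Ideal public

  _⊆ᴵ_ : Ideal → Ideal → Set (c ⊔ ℓ)
  I ⊆ᴵ J = ∀ x → mem I x → mem J x

  SameIdeal : Ideal → Ideal → Set (c ⊔ ℓ)
  SameIdeal I J = I ⊆ᴵ J × J ⊆ᴵ I

  Proper : Ideal → Set (c ⊔ ℓ)
  Proper I = ¬ mem I 1#

  NonzeroIdeal : Ideal → Set (c ⊔ ℓ)
  NonzeroIdeal I = ∃ λ x → mem I x × ¬ (x ≈ 0#)

  IsPrimeIdeal : Ideal → Set (c ⊔ ℓ)
  IsPrimeIdeal P = Proper P × (∀ a b → mem P (a * b) → mem P a ⊎ mem P b)

  IsMaximalIdeal : Ideal → Set (suc (c ⊔ ℓ))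
  IsMaximalIdeal M = Proper M × (∀ J → M ⊆ᴵ J → J ⊆ᴵ M ⊎ mem J 1#)

  LinComb : List Carrier → Carrier → Set (c ⊔ ℓ)
  LinComb []       x = Lift' (x ≈ 0#)
    where Lift' = Level.Lift (c ⊔ ℓ)
  LinComb (g ∷ gs) x = ∃ λ r → ∃ λ y → LinComb gs y × x ≈ r * g + y

  FinitelyGenerated : Ideal → Set (c ⊔ ℓ)
  FinitelyGenerated J = ∃ λ gs → ∀ x → (mem J x → LinComb gs x) × (LinComb gs x → mem J x)

  pow : Carrier → ℕ → Carrier
  pow a zero     = 1#
  pow a (sucℕ n) = a * pow a n

  -- homogenisation b^n f(a/b) of the monic polynomial
  -- f(X) = X^n + d₁ X^(n-1) + ... + dₙ, with ds = d₁ ∷ ... ∷ dₙ (Horner form)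
  monicHom : Carrier → Carrier → List Carrier → Carrier
  monicHom a b ds = go 0 1# ds
    where
    go : ℕ → Carrier → List Carrier → Carrier
    go k acc []       = acc
    go k acc (d ∷ ds) = go (sucℕ k) (acc * a + d * pow b (sucℕ k)) ds

  _∣ᴿ_ : Carrier → Carrier → Set (c ⊔ ℓ)
  b ∣ᴿ a = ∃ λ r → a ≈ r * b

  IsIntegralDomain : Set (c ⊔ ℓ)
  IsIntegralDomain = ¬ (1# ≈ 0#) × (∀ a b → a * b ≈ 0# → a ≈ 0# ⊎ b ≈ 0#)

  -- integrally closed in its field of fractions: if a/b (b ≠ 0) is a root of
  -- a monic polynomial over R, then a/b ∈ R, i.e. b divides a
  IsIntegrallyClosed : Set (c ⊔ ℓ)
  IsIntegrallyClosed = ∀ a b ds → ¬ (b ≈ 0#) → monicHom a b ds ≈ 0# → b ∣ᴿ a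

  IsNoetherian : Set (suc (c ⊔ ℓ))
  IsNoetherian = ∀ J → FinitelyGenerated J

  NonzeroPrimesMaximal : Set (suc (c ⊔ ℓ))
  NonzeroPrimesMaximal = ∀ P → IsPrimeIdeal P → NonzeroIdeal P → IsMaximalIdeal P

  IsDedekindDomain : Set (suc (c ⊔ ℓ))
  IsDedekindDomain = IsIntegralDomain × IsNoetherian × IsIntegrallyClosed × NonzeroPrimesMaximal

  _≡[_]_ : Carrier → Ideal → Carrier → Set (c ⊔ ℓ)
  a ≡[ I ] b = mem I (a + (- b))

  -- |R/I| = n : a complete, irredundant list of n coset representatives
  HasSize : Ideal → ℕ → Set (c ⊔ ℓ)
  HasSize I n = ∃ λ (xs : List Carrier) → length xs ≡ n
              × AllPairs (λ a b → ¬ (a ≡[ I ] b)) xs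
              × (∀ x → Any (λ a → x ≡[ I ] a) xs)

  UnitMod : Ideal → Carrier → Set (c ⊔ ℓ)
  UnitMod I a = ∃ λ b → (a * b) ≡[ I ] 1#

  -- unitary Cayley graph G_{R/I}; vertices are cosets, represented by elements of R
  Adj : Ideal → Carrier → Carrier → Set (c ⊔ ℓ)
  Adj I a b = UnitMod I (a + (- b))

  IsClique : Ideal → List Carrier → Set (c ⊔ ℓ)
  IsClique I D = AllPairs (λ a b → ¬ (a ≡[ I ] b) × Adj I a b) D

  Dominates : Ideal → List Carrier → Set (c ⊔ ℓ)
  Dominates I D = ∀ x → Any (λ d → x ≡[ I ] d) D ⊎ Any (λ d → Adj I x d) D

  IsDominatingClique : Ideal → List Carrier → Set (c ⊔ ℓ)
  IsDominatingClique I D = IsClique I D × Dominates I D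

  GammaCl : Ideal → ℕ → Set (c ⊔ ℓ)
  GammaCl I k = (∃ λ D → IsDominatingClique I D × length D ≡ k)
              × (∀ D → IsDominatingClique I D → k ≤ length D)

  GammaClExists : Ideal → Set (c ⊔ ℓ)
  GammaClExists I = ∃ λ D → IsDominatingClique I D

  -- in a Dedekind domain, P divides I iff I ⊆ P
  IsPrimeDivisor : Ideal → Ideal → Set (c ⊔ ℓ)
  IsPrimeDivisor I P = IsPrimeIdeal P × I ⊆ᴵ P

  Lambda : Ideal → ℕ → Set (suc (c ⊔ ℓ))
  Lambda I m = ∃ λ (Ps : List Ideal) → length Ps ≡ m
             × AllPairs (λ P P′ → ¬ SameIdeal P P′) Ps
             × All (IsPrimeDivisor I) Ps
             × (∀ P → IsPrimeDivisor I P → Any (SameIdeal P) Ps)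

  Qval : Ideal → ℕ → Set (suc (c ⊔ ℓ))
  Qval I q = (∃ λ P → IsPrimeDivisor I P × HasSize P q)
           × (∀ P n → IsPrimeDivisor I P → HasSize P n → q ≤ n)

{-# OPTIONS --safe #-}
module Submission where

-- Over a Dedekind domain the prime divisors P₁ … P_λ of I are maximal, hence pairwise
-- comaximal, and a + I is a unit exactly when a lies in no Pᵢ.  If a vertex x has no
-- neighbour in a clique D, the primes containing x − d (d ∈ D) are pairwise distinct, so
-- there are |D| distinct prime divisors.  Conversely, if 2 ≤ |D| ≤ λ(I), the Chinese
-- remainder theorem gives y ≡ dᵢ (mod Pᵢ), a vertex with no neighbour in D; since a vertex
-- congruent to one element of a clique is adjacent to all the others, D does not dominate y.
-- A single vertex dominates only when R/I is a field.  Hence dominating cliques have more than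
-- λ(I) vertices, a clique of minimum order cannot miss a vertex, and no clique has more than
-- |R/P| vertices for a prime divisor P.  When Q(I) > λ(I), choosing λ(I) + 1 residues distinct
-- modulo each Pᵢ and gluing them by CRT yields λ(I) + 1 elements pairwise incongruent modulo
-- every Pᵢ: a clique which dominates by the first remark.

open import Level using (Level; _⊔_)
open import Algebra.Bundles using (CommutativeRing)
open import Data.Fin.Base using (Fin; zero; suc; inject≤)
open import Data.Fin.Properties using (_≟_; injective⇒≤; inject≤-injective; suc-injective)
open import Data.Integer.Base as ℤ using (ℤ; +_; -[1+_]; _⊖_; _◃_; sign; ∣_∣; +-*-rawRing)
import Data.Integer.Properties as ℤ
open import Data.List.Base using (List; []; _∷_; length; lookup; tabulate; filter; deduplicate)
open import Data.List.Properties using (length-tabulate; filter-notAll)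
open import Data.List.Membership.Propositional using (lose)
open import Data.List.Membership.Propositional.Properties using (∈-lookup)
open import Data.List.Relation.Unary.All as All using (All; []; _∷_)
open import Data.List.Relation.Unary.AllPairs as AllPairs using (AllPairs; []; _∷_)
import Data.List.Relation.Unary.AllPairs.Properties as AllPairs
open import Data.List.Relation.Unary.Any as Any using (Any; here; there; any?)
open import Data.List.Relation.Unary.Any.Properties using (lookup-index)
import Data.List.Relation.Unary.Any.Properties as Any
open import Data.List.Relation.Unary.Enumerates.Setoid.Properties using (deduplicate⁺)
open import Data.List.Relation.Unary.Unique.DecSetoid.Properties using (deduplicate-!)
open import Data.Maybe.Base using (Maybe; just; nothing)
open import Data.Nat.Base as ℕ using (ℕ; zero; suc; _≤_; _<_; z≤n; s≤s)
open import Data.Nat.Properties as ℕ using (≤-trans; ≤-reflexive; m≤n⇒m≤1+n; m<n⇒m<1+n; ≰⇒>; <⇒≱)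
open import Data.Product.Base using (Σ; ∃; ∃₂; _×_; _,_; proj₁; proj₂; uncurry)
open import Data.Sign.Base as Sign using (Sign)
open import Data.Sum.Base as Sum using (_⊎_; inj₁; inj₂; [_,_]′)
open import Function.Base using (_∘_; id)
open import Relation.Binary.Bundles using (DecSetoid)
open import Relation.Binary.Core using (Rel)
open import Relation.Binary.Definitions using (Symmetric)
open import Relation.Binary.Structures using (IsEquivalence)
open import Relation.Binary.PropositionalEquality as ≡ using (_≡_; _≢_)
open import Relation.Nullary using (¬_; Dec; yes; no; contradiction)
open import Relation.Nullary.Decidable using (decidable-stable; map′; ¬?; _×-dec_)
open import Relation.Unary using (Pred; Decidable; _⊆_)
open import Defs

private variable
  ℓ₁ ℓ₂ ℓ₃ : Level
  A : Set ℓ₁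
  k m m′ n : ℕ

AllPairs-lookup : {R : Rel A ℓ₂} → Symmetric R → {xs : List A} → AllPairs R xs →
                  ∀ {i j} → i ≢ j → R (lookup xs i) (lookup xs j)
AllPairs-lookup sym (_ ∷ _)    {zero}  {zero}  0≢0 = contradiction ≡.refl 0≢0
AllPairs-lookup sym (Rx ∷ _)   {zero}  {suc j} _   = All.lookup Rx (∈-lookup j)
AllPairs-lookup sym (Rx ∷ _)   {suc i} {zero}  _   = sym (All.lookup Rx (∈-lookup i))
AllPairs-lookup sym (_ ∷ Rxs)  {suc i} {suc j} i≢j = AllPairs-lookup sym Rxs (i≢j ∘ ≡.cong suc)

≢-preserving⇒≤ : {f : Fin m → Fin n} → (∀ {i j} → i ≢ j → f i ≢ f j) → m ≤ n
≢-preserving⇒≤ separates = injective⇒≤ λ {i} {j} fi≡fj →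
  decidable-stable (i ≟ j) (λ i≢j → separates i≢j fi≡fj)

spend-fuel : n ≤ m ℕ.+ suc k → m < m′ → n ≤ m′ ℕ.+ k
spend-fuel {m = m} {k = k} n≤m+1+k m<m′ =
  ≤-trans n≤m+1+k (≤-trans (≤-reflexive (ℕ.+-suc m k)) (ℕ.+-monoˡ-≤ k m<m′))

module _ {P : Pred A ℓ₂} {Q : Pred A ℓ₃} (P? : Decidable P) (Q? : Decidable Q) (P⊆Q : P ⊆ Q) where

  length-filter-mono : ∀ xs → length (filter P? xs) ≤ length (filter Q? xs)
  length-filter-mono []       = z≤n
  length-filter-mono (x ∷ xs) with P? x | Q? x
  ... | yes _  | yes _  = s≤s (length-filter-mono xs)
  ... | yes Px | no ¬Qx = contradiction (P⊆Q Px) ¬Qx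
  ... | no _   | yes _  = m≤n⇒m≤1+n (length-filter-mono xs)
  ... | no _   | no _   = length-filter-mono xs

  length-filter-mono-< : ∀ {xs} → Any (λ x → Q x × ¬ P x) xs →
                         length (filter P? xs) < length (filter Q? xs)
  length-filter-mono-< {x ∷ xs} (here (Qx , ¬Px)) with P? x | Q? x
  ... | yes Px | _      = contradiction Px ¬Px
  ... | no _   | yes _  = s≤s (length-filter-mono xs)
  ... | no _   | no ¬Qx = contradiction Qx ¬Qx
  length-filter-mono-< {x ∷ xs} (there witness) with P? x | Q? x
  ... | yes _  | yes _  = s≤s (length-filter-mono-< witness)
  ... | yes Px | no ¬Qx = contradiction (P⊆Q Px) ¬Qx
  ... | no _   | yes _  = m<n⇒m<1+n (length-filter-mono-< witness)
  ... | no _   | no _   = length-filter-mono-< witness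

-- The ring solver needs a coefficient ring with decidable equality; ℤ maps to R by n ↦ n · 1#.
module RingSolver {c ℓ : Level} (R : CommutativeRing c ℓ) where
  open CommutativeRing R
  open import Algebra.Properties.Ring ring using (-‿involutive; -0#≈0#; -‿distribˡ-*; -‿distribʳ-*; -‿+-comm)
  open import Algebra.Properties.CommutativeSemigroup +-commutativeSemigroup using (interchange)
  open import Algebra.Properties.Semiring.Mult.TCOptimised semiring using (1+×; ×-homo-+; ×1-homo-*)
    renaming (_×_ to _·_)
  open import Algebra.Solver.Ring.AlmostCommutativeRing using (fromCommutativeRing; _-Raw-AlmostCommutative⟶_)
  open import Relation.Binary.Reasoning.Setoid setoid

  signed : Sign → Carrier → Carrier
  signed Sign.+ x = x
  signed Sign.- x = - x

  -- With the TCOptimised multiple, ⟦ + 1 ⟧ reduces to 1#, so con (+ 1) stands for 1# in equations.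
  ⟦_⟧ : ℤ → Carrier
  ⟦ + n ⟧      = n · 1#
  ⟦ -[1+ n ] ⟧ = - (suc n · 1#)

  ⟦⟧-signed : ∀ i → ⟦ i ⟧ ≈ signed (sign i) (∣ i ∣ · 1#)
  ⟦⟧-signed (+ n)      = refl
  ⟦⟧-signed -[1+ n ]   = refl

  ◃-homo : ∀ s n → ⟦ s ◃ n ⟧ ≈ signed s (n · 1#)
  ◃-homo Sign.+ zero    = refl
  ◃-homo Sign.- zero    = sym -0#≈0#
  ◃-homo Sign.+ (suc n) = refl
  ◃-homo Sign.- (suc n) = refl

  signed-* : ∀ s t x y → signed s x * signed t y ≈ signed (s Sign.* t) (x * y)
  signed-* Sign.+ Sign.+ x y = refl
  signed-* Sign.+ Sign.- x y = sym (-‿distribʳ-* x y)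
  signed-* Sign.- Sign.+ x y = sym (-‿distribˡ-* x y)
  signed-* Sign.- Sign.- x y = begin
    - x * - y     ≈⟨ -‿distribˡ-* x (- y) ⟨
    - (x * - y)   ≈⟨ -‿cong (-‿distribʳ-* x y) ⟨
    - - (x * y)   ≈⟨ -‿involutive (x * y) ⟩
    x * y         ∎

  ⊖-homo : ∀ m n → ⟦ m ⊖ n ⟧ ≈ m · 1# - n · 1#
  ⊖-homo zero    zero    = sym (-‿inverseʳ 0#)
  ⊖-homo zero    (suc n) = sym (+-identityˡ _)
  ⊖-homo (suc m) zero    = sym (trans (+-congˡ -0#≈0#) (+-identityʳ _))
  ⊖-homo (suc m) (suc n) = begin
    ⟦ suc m ⊖ suc n ⟧                     ≡⟨ ≡.cong ⟦_⟧ (ℤ.[1+m]⊖[1+n]≡m⊖n m n) ⟩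
    ⟦ m ⊖ n ⟧                             ≈⟨ ⊖-homo m n ⟩
    m · 1# - n · 1#                       ≈⟨ +-identityˡ _ ⟨
    0# + (m · 1# - n · 1#)                ≈⟨ +-congʳ (-‿inverseʳ 1#) ⟨
    (1# - 1#) + (m · 1# - n · 1#)         ≈⟨ interchange 1# (- 1#) (m · 1#) (- (n · 1#)) ⟩
    (1# + m · 1#) + (- 1# - n · 1#)       ≈⟨ +-congˡ (-‿+-comm 1# (n · 1#)) ⟩
    (1# + m · 1#) - (1# + n · 1#)         ≈⟨ +-cong (1+× m 1#) (-‿cong (1+× n 1#)) ⟨
    suc m · 1# - suc n · 1#               ∎

  +-homo : ∀ i j → ⟦ i ℤ.+ j ⟧ ≈ ⟦ i ⟧ + ⟦ j ⟧
  +-homo (+ m)      (+ n)      = ×-homo-+ 1# m n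
  +-homo (+ m)      -[1+ n ]   = ⊖-homo m (suc n)
  +-homo -[1+ m ]   (+ n)      = trans (⊖-homo n (suc m)) (+-comm _ _)
  +-homo -[1+ m ]   -[1+ n ]   = begin
    - (suc (suc (m ℕ.+ n)) · 1#)          ≡⟨ ≡.cong (λ k → - (suc k · 1#)) (ℕ.+-suc m n) ⟨
    - ((suc m ℕ.+ suc n) · 1#)            ≈⟨ -‿cong (×-homo-+ 1# (suc m) (suc n)) ⟩
    - (suc m · 1# + suc n · 1#)           ≈⟨ -‿+-comm _ _ ⟨
    - (suc m · 1#) - suc n · 1#           ∎

  signed-cong : ∀ s {x y} → x ≈ y → signed s x ≈ signed s y
  signed-cong Sign.+ x≈y = x≈y
  signed-cong Sign.- x≈y = -‿cong x≈y

  *-homo : ∀ i j → ⟦ i ℤ.* j ⟧ ≈ ⟦ i ⟧ * ⟦ j ⟧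
  *-homo i j = begin
    ⟦ s ◃ ∣ i ∣ ℕ.* ∣ j ∣ ⟧                                 ≈⟨ ◃-homo s (∣ i ∣ ℕ.* ∣ j ∣) ⟩
    signed s ((∣ i ∣ ℕ.* ∣ j ∣) · 1#)                        ≈⟨ signed-cong s (×1-homo-* ∣ i ∣ ∣ j ∣) ⟩
    signed s (∣ i ∣ · 1# * ∣ j ∣ · 1#)                       ≈⟨ signed-* (sign i) (sign j) _ _ ⟨
    signed (sign i) (∣ i ∣ · 1#) * signed (sign j) (∣ j ∣ · 1#) ≈⟨ *-cong (⟦⟧-signed i) (⟦⟧-signed j) ⟨
    ⟦ i ⟧ * ⟦ j ⟧                                           ∎
    where s = sign i Sign.* sign j

  -‿homo : ∀ i → ⟦ ℤ.- i ⟧ ≈ - ⟦ i ⟧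
  -‿homo (+ zero)    = sym -0#≈0#
  -‿homo (+ suc n)   = refl
  -‿homo -[1+ n ]    = sym (-‿involutive _)

  homomorphism : +-*-rawRing -Raw-AlmostCommutative⟶ fromCommutativeRing R
  homomorphism = record
    { ⟦_⟧ = ⟦_⟧ ; +-homo = +-homo ; *-homo = *-homo ; -‿homo = -‿homo
    ; 0-homo = refl ; 1-homo = refl }

  ⟦⟧-≟ : ∀ i j → Maybe (⟦ i ⟧ ≈ ⟦ j ⟧)
  ⟦⟧-≟ i j with i ℤ.≟ j
  ... | yes ≡.refl = just refl
  ... | no _       = nothing

  open import Algebra.Solver.Ring +-*-rawRing (fromCommutativeRing R) homomorphism ⟦⟧-≟ public
    using (solve; _:=_; _:+_; _:-_; _:*_; :-_; con)


module IdealTheory {c ℓ : Level} (R : CommutativeRing c ℓ) where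
  open CommutativeRing R hiding (zero)
  open RingTheory R
  open RingSolver R
  open import Algebra.Properties.Ring ring using (-1*x≈-x)
  open import Algebra.Properties.CommutativeSemigroup +-commutativeSemigroup using (interchange)

  private variable
    a a′ b b′ d d₀ d₁ x z : Carrier
    D ds : List Carrier
    J K P Q : Ideal

  -- Ideals are never inferable from mem J x (a projection), hence the explicit J here and
  -- the named ideal arguments below.
  module _ (J : Ideal) where

    -‿mem : mem J x → mem J (- x)
    -‿mem {x = x} x∈J = resp J (-1*x≈-x x) (*-mem J (- 1#) x∈J)

    ≡[]-refl : a ≡[ J ] a
    ≡[]-refl {a = a} = resp J (sym (-‿inverseʳ a)) (zero-mem J)

    ≡[]-sym : a ≡[ J ] b → b ≡[ J ] a
    ≡[]-sym {a = a} {b = b} a≡b =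
      resp J (solve 2 (λ a b → :- (a :- b) := b :- a) refl a b) (-‿mem a≡b)

    ≡[]-trans : a ≡[ J ] b → b ≡[ J ] z → a ≡[ J ] z
    ≡[]-trans {a = a} {b = b} {z = z} a≡b b≡z =
      resp J (solve 3 (λ a b z → (a :- b) :+ (b :- z) := a :- z) refl a b z) (+-mem J a≡b b≡z)

    ≡[]-isEquivalence : IsEquivalence (_≡[ J ]_)
    ≡[]-isEquivalence = record { refl = ≡[]-refl ; sym = ≡[]-sym ; trans = ≡[]-trans }

    ≈⇒≡[] : a ≈ b → a ≡[ J ] b
    ≈⇒≡[] {b = b} a≈b = resp J (sym (trans (+-congʳ a≈b) (-‿inverseʳ b))) (zero-mem J)

    +-cong-≡[] : a ≡[ J ] a′ → b ≡[ J ] b′ → (a + b) ≡[ J ] (a′ + b′)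
    +-cong-≡[] {a = a} {a′ = a′} {b = b} {b′ = b′} a≡a′ b≡b′ =
      resp J (solve 4 (λ a a′ b b′ → (a :- a′) :+ (b :- b′) := (a :+ b) :- (a′ :+ b′)) refl a a′ b b′)
        (+-mem J a≡a′ b≡b′)

    *-cong-≡[] : a ≡[ J ] a′ → b ≡[ J ] b′ → (a * b) ≡[ J ] (a′ * b′)
    *-cong-≡[] {a = a} {a′ = a′} {b = b} {b′ = b′} a≡a′ b≡b′ =
      resp J (solve 4 (λ a a′ b b′ → b :* (a :- a′) :+ a′ :* (b :- b′) := a :* b :- a′ :* b′) refl a a′ b b′)
        (+-mem J (*-mem J b a≡a′) (*-mem J a′ b≡b′))

    ∈-resp-≡[] : a ≡[ J ] b → mem J b → mem J a
    ∈-resp-≡[] {a = a} {b = b} a≡b b∈J =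
      resp J (solve 2 (λ a b → (a :- b) :+ b := a) refl a b) (+-mem J a≡b b∈J)

    ∈⇒≡[]0 : mem J a → a ≡[ J ] 0#
    ∈⇒≡[]0 {a = a} a∈J = resp J (solve 1 (λ a → a := a :- con (+ 0)) refl a) a∈J

  SameIdeal-sym : SameIdeal J K → SameIdeal K J
  SameIdeal-sym (J⊆K , K⊆J) = K⊆J , J⊆K

  SameIdeal-trans : SameIdeal J K → SameIdeal K P → SameIdeal J P
  SameIdeal-trans (J⊆K , K⊆J) (K⊆P , P⊆K) = (λ x → K⊆P x ∘ J⊆K x) , (λ x → K⊆J x ∘ P⊆K x)

  UnitMod-resp-≈ : a ≈ b → UnitMod J a → UnitMod J b
  UnitMod-resp-≈ {J = J} a≈b (c , ac≡1) = c , resp J (+-congʳ (*-congʳ a≈b)) ac≡1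

  ∈-proper⇒¬UnitMod : J ⊆ᴵ P → Proper P → mem P a → ¬ UnitMod J a
  ∈-proper⇒¬UnitMod {P = P} {a = a} J⊆P P-proper a∈P (c , ac≡1) =
    P-proper (∈-resp-≡[] P (≡[]-sym P (J⊆P _ ac≡1)) (resp P (*-comm c a) (*-mem P c a∈P)))

  ∈-prime-divisor⇒¬UnitMod : IsPrimeDivisor J P → mem P a → ¬ UnitMod J a
  ∈-prime-divisor⇒¬UnitMod {J = J} {P = P} ((P-proper , _) , J⊆P) = ∈-proper⇒¬UnitMod {J = J} {P = P} J⊆P P-proper

  Adj-sym : Adj J a b → Adj J b a
  Adj-sym {J = J} {a = a} {b = b} (c , u) =
    - c , resp J (solve 3 (λ a b c → (a :- b) :* c :- con (+ 1) := (b :- a) :* (:- c) :- con (+ 1)) refl a b c) u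

  Adj-respˡ-≡[] : a ≡[ J ] a′ → Adj J a′ b → Adj J a b
  Adj-respˡ-≡[] {J = J} a≡a′ (c , u) =
    c , ≡[]-trans J (*-cong-≡[] J (+-cong-≡[] J a≡a′ (≡[]-refl J)) (≡[]-refl J)) u

  Adj⇒≢ : Proper J → Adj J a b → ¬ a ≡[ J ] b
  Adj⇒≢ {J = J} J-proper adj a≡b = ∈-proper⇒¬UnitMod {J = J} {P = J} (λ _ → id) J-proper a≡b adj

  clique-lookup : IsClique J D → ∀ {i j} → i ≢ j → Adj J (lookup D i) (lookup D j)
  clique-lookup {J = J} clique = AllPairs-lookup (Adj-sym {J = J}) (AllPairs.map proj₂ clique)

  infixl 25 _+ᴵ_ _+⟨_⟩ _∶_

  _+ᴵ_ : Ideal → Ideal → Ideal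
  P +ᴵ Q = record
    { mem      = λ x → ∃₂ λ p q → mem P p × mem Q q × x ≈ p + q
    ; resp     = λ x≈y (p , q , p∈P , q∈Q , x≈p+q) → p , q , p∈P , q∈Q , trans (sym x≈y) x≈p+q
    ; zero-mem = 0# , 0# , zero-mem P , zero-mem Q , sym (+-identityʳ 0#)
    ; +-mem    = λ (p , q , p∈P , q∈Q , x≈p+q) (p′ , q′ , p′∈P , q′∈Q , y≈p′+q′) →
                   p + p′ , q + q′ , +-mem P p∈P p′∈P , +-mem Q q∈Q q′∈Q ,
                   trans (+-cong x≈p+q y≈p′+q′) (interchange p q p′ q′)
    ; *-mem    = λ t (p , q , p∈P , q∈Q , x≈p+q) →
                   t * p , t * q , *-mem P t p∈P , *-mem Q t q∈Q , trans (*-congˡ x≈p+q) (distribˡ t p q)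
    }

  ⊆-+ᴵˡ : P ⊆ᴵ P +ᴵ Q
  ⊆-+ᴵˡ {P = P} {Q = Q} x x∈P = x , 0# , x∈P , zero-mem Q , sym (+-identityʳ x)

  ⊆-+ᴵʳ : Q ⊆ᴵ P +ᴵ Q
  ⊆-+ᴵʳ {P = P} x x∈Q = 0# , x , zero-mem P , x∈Q , sym (+-identityˡ x)

  _+⟨_⟩ : Ideal → Carrier → Ideal
  J +⟨ a ⟩ = record
    { mem      = λ x → ∃ λ r → x ≡[ J ] (r * a)
    ; resp     = λ x≈y (r , x≡ra) → r , ≡[]-trans J (≈⇒≡[] J (sym x≈y)) x≡ra
    ; zero-mem = 0# , ≈⇒≡[] J (sym (zeroˡ a))
    ; +-mem    = λ (r , x≡ra) (s , y≡sa) →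
                   r + s , ≡[]-trans J (+-cong-≡[] J x≡ra y≡sa) (≈⇒≡[] J (sym (distribʳ a r s)))
    ; *-mem    = λ t (r , x≡ra) →
                   t * r , ≡[]-trans J (*-cong-≡[] J (≡[]-refl J) x≡ra) (≈⇒≡[] J (sym (*-assoc t r a)))
    }

  ⊆-+⟨⟩ : J ⊆ᴵ J +⟨ a ⟩
  ⊆-+⟨⟩ {J = J} {a = a} x x∈J = 0# , ≡[]-trans J (∈⇒≡[]0 J x∈J) (≈⇒≡[] J (sym (zeroˡ a)))

  ∈-+⟨⟩ : mem (J +⟨ a ⟩) a
  ∈-+⟨⟩ {J = J} {a = a} = 1# , ≈⇒≡[] J (sym (*-identityˡ a))

  1∈+⟨⟩⇒UnitMod : mem (J +⟨ a ⟩) 1# → UnitMod J a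
  1∈+⟨⟩⇒UnitMod {J = J} {a = a} (r , 1≡ra) = r , ≡[]-trans J (≈⇒≡[] J (*-comm a r)) (≡[]-sym J 1≡ra)

  _∶_ : Ideal → Carrier → Ideal
  K ∶ d = record
    { mem      = λ x → mem K (x * d)
    ; resp     = λ x≈y → resp K (*-congʳ x≈y)
    ; zero-mem = resp K (sym (zeroˡ d)) (zero-mem K)
    ; +-mem    = λ xd∈K yd∈K → resp K (sym (distribʳ d _ _)) (+-mem K xd∈K yd∈K)
    ; *-mem    = λ t xd∈K → resp K (sym (*-assoc t _ d)) (*-mem K t xd∈K)
    }

  ⊆-∶ : K ⊆ᴵ K ∶ d
  ⊆-∶ {K = K} {d = d} x x∈K = resp K (*-comm d x) (*-mem K d x∈K)

  Comaximal : Ideal → Ideal → Set (c ⊔ ℓ)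
  Comaximal P Q = mem (P +ᴵ Q) 1#

  distinct-maximal⇒comaximal : IsMaximalIdeal P → IsMaximalIdeal Q → ¬ SameIdeal P Q → Comaximal P Q
  distinct-maximal⇒comaximal {P = P} {Q = Q} (_ , P-maximal) (Q-proper , Q-maximal) P≠Q
    with Q-maximal (P +ᴵ Q) (⊆-+ᴵʳ {Q = Q} {P = P})
  ... | inj₂ 1∈P+Q = 1∈P+Q
  ... | inj₁ P+Q⊆Q with P-maximal Q (λ x → P+Q⊆Q x ∘ ⊆-+ᴵˡ {P = P} {Q = Q} x)
  ...   | inj₁ Q⊆P = contradiction ((λ x → P+Q⊆Q x ∘ ⊆-+ᴵˡ {P = P} {Q = Q} x) , Q⊆P) P≠Q
  ...   | inj₂ 1∈Q = contradiction 1∈Q Q-proper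

  comaximal⇒≡1 : Comaximal P Q → ∃ λ q → mem Q q × q ≡[ P ] 1#
  comaximal⇒≡1 {P = P} (p , q , p∈P , q∈Q , 1≈p+q) = q , q∈Q , ≡[]-trans P q≡p+q (≈⇒≡[] P (sym 1≈p+q))
    where
    q≡p+q : q ≡[ P ] (p + q)
    q≡p+q = ≡[]-trans P (≈⇒≡[] P (sym (+-identityˡ q))) (+-cong-≡[] P (≡[]-sym P (∈⇒≡[]0 P p∈P)) (≡[]-refl P))

  -- Opaque: unfolding these constructions during conversion checking is prohibitively expensive.
  opaque
    separating-element : (Q : Fin k → Ideal) → (∀ i → Comaximal P (Q i)) →
                         ∃ λ e → e ≡[ P ] 1# × (∀ i → mem (Q i) e)
    separating-element {zero}  {P = P} Q _ = 1# , ≡[]-refl P , λ ()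
    separating-element {suc k} {P = P} Q comaximal
      with separating-element {P = P} (Q ∘ suc) (comaximal ∘ suc) | comaximal⇒≡1 {P = P} {Q = Q zero} (comaximal zero)
    ... | e , e≡1 , e∈Q | q , q∈Q₀ , q≡1 =
      q * e , ≡[]-trans P (*-cong-≡[] P q≡1 e≡1) (≈⇒≡[] P (*-identityˡ 1#)) , λ where
        zero    → resp (Q zero) (*-comm e q) (*-mem (Q zero) e q∈Q₀)
        (suc i) → *-mem (Q (suc i)) q (e∈Q i)

    chinese-remainder : (P : Fin k → Ideal) → (∀ {i j} → i ≢ j → Comaximal (P i) (P j)) →
                        (t : Fin k → Carrier) → ∃ λ y → ∀ i → y ≡[ P i ] t i
    chinese-remainder {zero}  P _ t = 0# , λ ()
    -- y + (t₀ − y) e agrees with y where e vanishes and with t₀ where e ≡ 1.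
    chinese-remainder {suc k} P comaximal t
      with y , y≡t ← chinese-remainder (P ∘ suc) (λ i≢j → comaximal (i≢j ∘ suc-injective)) (t ∘ suc)
      with e , e≡1 , e∈P ← separating-element {P = P zero} (P ∘ suc) (λ i → comaximal {zero} {suc i} λ ())
      = y + (t zero - y) * e , λ where
          zero    → ≡[]-trans (P zero) (replace-e {Q = P zero} e≡1)
                      (≈⇒≡[] (P zero) (solve 2 (λ y t → y :+ (t :- y) :* con (+ 1) := t) refl y (t zero)))
          (suc i) → ≡[]-trans (P (suc i)) (replace-e {Q = P (suc i)} (∈⇒≡[]0 (P (suc i)) (e∈P i)))
                      (≡[]-trans (P (suc i))
                        (≈⇒≡[] (P (suc i)) (solve 2 (λ y u → y :+ u :* con (+ 0) := y) refl y (t zero - y)))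
                        (y≡t i))
      where
      replace-e : ∀ {Q u} → e ≡[ Q ] u → (y + (t zero - y) * e) ≡[ Q ] (y + (t zero - y) * u)
      replace-e {Q} e≡u = +-cong-≡[] Q (≡[]-refl Q) (*-cong-≡[] Q (≡[]-refl Q) e≡u)

  incongruent-family : HasSize P n → k ≤ n → Σ (Fin k → Carrier) λ r → ∀ {i j} → i ≢ j → ¬ r i ≡[ P ] r j
  incongruent-family {P = P} (xs , ≡.refl , distinct , _) k≤n =
    (λ i → lookup xs (inject≤ i k≤n)) ,
    λ i≢j → AllPairs-lookup (λ ¬a≡b → ¬a≡b ∘ ≡[]-sym P) distinct (i≢j ∘ inject≤-injective _ _ _ _)

  prime-divisor-maximal : IsDedekindDomain → NonzeroIdeal J → IsPrimeDivisor J P → IsMaximalIdeal P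
  prime-divisor-maximal {P = P} (_ , _ , _ , dim≤1) (x , x∈J , x≉0) (P-prime , J⊆P) =
    dim≤1 P P-prime (x , J⊆P x x∈J , x≉0)

  -- For proper J: R/J is a field.
  ZeroOrUnitMod : Ideal → Set (c ⊔ ℓ)
  ZeroOrUnitMod J = ∀ z → mem J z ⊎ UnitMod J z

  maximal⇒ZeroOrUnitMod : IsMaximalIdeal J → ZeroOrUnitMod J
  maximal⇒ZeroOrUnitMod {J = J} (_ , J-maximal) z with J-maximal (J +⟨ z ⟩) (⊆-+⟨⟩ {J = J})
  ... | inj₁ J+z⊆J = inj₁ (J+z⊆J z (∈-+⟨⟩ {J = J}))
  ... | inj₂ 1∈J+z = inj₂ (1∈+⟨⟩⇒UnitMod {J = J} 1∈J+z)

  ZeroOrUnitMod⇒prime : Proper J → ZeroOrUnitMod J → IsPrimeIdeal J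
  ZeroOrUnitMod⇒prime {J = J} J-proper zero-or-unit = J-proper , primality
    where
    primality : ∀ a b → mem J (a * b) → mem J a ⊎ mem J b
    primality a b ab∈J with zero-or-unit a
    ... | inj₁ a∈J        = inj₁ a∈J
    ... | inj₂ (c , ac≡1) = inj₂ (∈-resp-≡[] J b≡c[ab] (*-mem J c ab∈J))
      where
      b≡c[ab] : b ≡[ J ] (c * (a * b))
      b≡c[ab] = ≡[]-trans J (≈⇒≡[] J (sym (*-identityˡ b)))
                 (≡[]-trans J (*-cong-≡[] J (≡[]-sym J ac≡1) (≡[]-refl J))
                   (≈⇒≡[] J (solve 3 (λ a b c → (a :* c) :* b := c :* (a :* b)) refl a b c)))

  singleton-dominates⇒ZeroOrUnitMod : Dominates J (d ∷ []) → ZeroOrUnitMod J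
  singleton-dominates⇒ZeroOrUnitMod {J = J} {d = d} dominates z =
    Sum.map (resp J z+d-d≈z ∘ Any.singleton⁻) (UnitMod-resp-≈ {J = J} z+d-d≈z ∘ Any.singleton⁻) (dominates (z + d))
    where
    z+d-d≈z : (z + d) - d ≈ z
    z+d-d≈z = solve 2 (λ z d → (z :+ d) :- d := z) refl z d

  ZeroOrUnitMod⇒singleton-dominates : ZeroOrUnitMod J → ∀ d → Dominates J (d ∷ [])
  ZeroOrUnitMod⇒singleton-dominates zero-or-unit d x = Sum.map here here (zero-or-unit (x - d))

  ¬Dominates-[] : ¬ Dominates J []
  ¬Dominates-[] dominates with dominates 0#
  ... | inj₁ ()
  ... | inj₂ ()

  clique-neighbour : IsClique J (d₀ ∷ d₁ ∷ ds) → Any (x ≡[ J ]_) (d₀ ∷ d₁ ∷ ds) → Any (Adj J x) (d₀ ∷ d₁ ∷ ds)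
  clique-neighbour {J = J} (((_ , adj₀₁) ∷ _) ∷ _) (here x≡d₀) = there (here (Adj-respˡ-≡[] {J = J} x≡d₀ adj₀₁))
  clique-neighbour {J = J} (clique₀ ∷ _) (there x≡dᵢ)
    with (_ , adj₀ᵢ) , x≡dᵢ ← All.lookupAny clique₀ x≡dᵢ = here (Adj-respˡ-≡[] {J = J} x≡dᵢ (Adj-sym {J = J} adj₀ᵢ))

  γcl-of-maximal : IsMaximalIdeal J → GammaCl J 1
  γcl-of-maximal {J = J} J-maximal = (0# ∷ [] , ([] ∷ [] , dominates) , ≡.refl) , nonempty
    where
    dominates : Dominates J (0# ∷ [])
    dominates = ZeroOrUnitMod⇒singleton-dominates {J = J} (maximal⇒ZeroOrUnitMod {J = J} J-maximal) 0#
    nonempty : ∀ D → IsDominatingClique J D → 1 ≤ length D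
    nonempty []      (_ , dominates) = contradiction dominates (¬Dominates-[] {J = J})
    nonempty (_ ∷ _) _               = s≤s z≤n

  clique-length-≤ : IsPrimeDivisor J P → HasSize P n → IsClique J D → length D ≤ n
  clique-length-≤ {J = J} {P = P} {D = D} divisor (ys , ≡.refl , _ , cover) clique = ≢-preserving⇒≤ separated
    where
    slot : Fin (length D) → Fin (length ys)
    slot i = Any.index (cover (lookup D i))
    separated : ∀ {i j} → i ≢ j → slot i ≢ slot j
    separated {i} {j} i≢j same-slot = ∈-prime-divisor⇒¬UnitMod {J = J} {P = P} divisor
      (≡[]-trans P (lookup-index (cover (lookup D i)))
        (≡.subst (λ s → lookup ys s ≡[ P ] lookup D j) (≡.sym same-slot)
          (≡[]-sym P (lookup-index (cover (lookup D j))))))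
      (clique-lookup {J = J} clique i≢j)

  module FiniteQuotient
    (I : Ideal) (I-proper : Proper I)
    (residues : List Carrier)
    (residues-distinct : AllPairs (λ a b → ¬ a ≡[ I ] b) residues)
    (residues-cover : ∀ x → Any (x ≡[ I ]_) residues)
    where

    residue : Carrier → Fin (length residues)
    residue x = Any.index (residues-cover x)

    ≡-residue : x ≡[ I ] lookup residues (residue x)
    ≡-residue = lookup-index (residues-cover _)

    ≡[]? : ∀ a b → Dec (a ≡[ I ] b)
    ≡[]? a b with residue a ≟ residue b
    ... | yes same = yes (≡[]-trans I ≡-residue
                           (≡.subst (λ s → lookup residues s ≡[ I ] b) (≡.sym same) (≡[]-sym I ≡-residue)))
    ... | no differ = no λ a≡b → AllPairs-lookup (λ ¬≡ → ¬≡ ∘ ≡[]-sym I) residues-distinct differ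
                                   (≡[]-trans I (≡[]-sym I ≡-residue) (≡[]-trans I a≡b ≡-residue))

    ∃-residue? : {Pr : Carrier → Set (c ⊔ ℓ)} → (∀ {a b} → a ≡[ I ] b → Pr a → Pr b) →
                 (∀ x → Dec (Pr x)) → Dec (∃ Pr)
    ∃-residue? resp-≡ Pr? =
      map′ Any.satisfied (λ (x , Prx) → Any.map (λ x≡r → resp-≡ x≡r Prx) (residues-cover x)) (any? Pr? residues)

    UnitMod? : ∀ a → Dec (UnitMod I a)
    UnitMod? a = ∃-residue? (λ b≡b′ ab≡1 → ≡[]-trans I (*-cong-≡[] I (≡[]-refl I) (≡[]-sym I b≡b′)) ab≡1)
                            (λ b → ≡[]? (a * b) 1#)

    +⟨⟩-mem? : ∀ a x → Dec (mem (I +⟨ a ⟩) x)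
    +⟨⟩-mem? a x = ∃-residue? (λ r≡r′ x≡ra → ≡[]-trans I x≡ra (*-cong-≡[] I r≡r′ (≡[]-refl I)))
                              (λ r → ≡[]? x (r * a))

    opaque
      HasSize-above : I ⊆ᴵ P → (∀ x → Dec (mem P x)) → ∃ λ n → HasSize P n
      HasSize-above {P = P} I⊆P mem? =
        length reps , reps , ≡.refl , deduplicate-! mod-P residues ,
        deduplicate⁺ mod-P (λ x → Any.map (I⊆P _) (residues-cover x))
        where
        mod-P : DecSetoid c (c ⊔ ℓ)
        mod-P = record
          { Carrier = Carrier ; _≈_ = _≡[ P ]_
          ; isDecEquivalence = record { isEquivalence = ≡[]-isEquivalence P ; _≟_ = λ a b → mem? (a - b) } }
        reps : List Carrier
        reps = deduplicate (DecSetoid._≟_ mod-P) residues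

    record ProperDecIdealAbove : Set (Level.suc (c ⊔ ℓ)) where
      field
        ideal   : Ideal
        member? : ∀ x → Dec (mem ideal x)
        above   : I ⊆ᴵ ideal
        proper  : Proper ideal
    open ProperDecIdealAbove

    residues-in : ProperDecIdealAbove → ℕ
    residues-in K = length (filter (member? K) residues)

    residues-in-<-length : ∀ K → residues-in K < length residues
    residues-in-<-length K = filter-notAll (member? K) residues
      (Any.map (λ 1≡r r∈K → proper K (∈-resp-≡[] (ideal K) (above K _ 1≡r) r∈K)) (residues-cover 1#))

    Enlarges : ProperDecIdealAbove → Carrier → Set (c ⊔ ℓ)
    Enlarges K d = ¬ mem (ideal K) d × Any (λ b → mem (ideal K ∶ d) b × ¬ mem (ideal K) b) residues

    enlarges? : ∀ K d → Dec (Enlarges K d)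
    enlarges? K d = ¬? (member? K d) ×-dec any? (λ b → member? K (b * d) ×-dec ¬? (member? K b)) residues

    _∶ₚ_ : (K : ProperDecIdealAbove) → ¬ mem (ideal K) d → ProperDecIdealAbove
    _∶ₚ_ {d = d} K d∉K = record
      { ideal   = ideal K ∶ d
      ; member? = λ x → member? K (x * d)
      ; above   = λ x → ⊆-∶ {K = ideal K} x ∘ above K x
      ; proper  = λ 1∈K∶d → d∉K (resp (ideal K) (*-identityˡ d) 1∈K∶d)
      }

    unenlargeable⇒prime : ∀ K → ¬ Any (Enlarges K) residues → IsPrimeIdeal (ideal K)
    unenlargeable⇒prime K unenlargeable = proper K , primality
      where
      primality : ∀ x y → mem (ideal K) (x * y) → mem (ideal K) x ⊎ mem (ideal K) y
      primality x y xy∈K with member? K x | member? K y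
      ... | yes x∈K | _       = inj₁ x∈K
      ... | no _    | yes y∈K = inj₂ y∈K
      ... | no x∉K  | no y∉K  = contradiction (Any.map enlarges (residues-cover y)) unenlargeable
        where
        K′ = ideal K
        enlarges : y ≡[ I ] d → Enlarges K d
        enlarges y≡d = (λ d∈K → y∉K (∈-resp-≡[] K′ (above K _ y≡d) d∈K)) , Any.map witness (residues-cover x)
          where
          witness : x ≡[ I ] b → mem (K′ ∶ _) b × ¬ mem K′ b
          witness x≡b =
            ∈-resp-≡[] K′ (*-cong-≡[] K′ (≡[]-sym K′ (above K _ x≡b)) (≡[]-sym K′ (above K _ y≡d))) xy∈K ,
            λ b∈K → x∉K (∈-resp-≡[] K′ (above K _ x≡b) b∈K)

    residues-in-grows : ∀ K (d∉K : ¬ mem (ideal K) d) → Any (λ b → mem (ideal K ∶ d) b × ¬ mem (ideal K) b) residues →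
                        residues-in K < residues-in (K ∶ₚ d∉K)
    residues-in-grows K d∉K = length-filter-mono-< (member? K) (member? (K ∶ₚ d∉K)) (⊆-∶ {K = ideal K} _)

    -- While some residues b, d ∉ K have bd ∈ K, pass to K ∶ d, which contains b: the number of
    -- residues in K grows, so the fuel |R/I| suffices, and an unenlargeable K is prime.
    prime-above : (fuel : ℕ) (K : ProperDecIdealAbove) → length residues ≤ residues-in K ℕ.+ fuel →
                  ∃ λ P → IsPrimeDivisor I P × ideal K ⊆ᴵ P
    prime-above zero K full =
      contradiction (≡.subst (length residues ≤_) (ℕ.+-identityʳ _) full) (<⇒≱ (residues-in-<-length K))
    prime-above (suc fuel) K full with any? (enlarges? K) residues
    ... | no unenlargeable = ideal K , (unenlargeable⇒prime K unenlargeable , above K) , λ _ → id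
    ... | yes enlarging
      with d , d∉K , witness ← Any.satisfied enlarging
      with P , P-divisor , K∶d⊆P ← prime-above fuel (K ∶ₚ d∉K) (spend-fuel full (residues-in-grows K d∉K witness))
      = P , P-divisor , λ x → K∶d⊆P x ∘ ⊆-∶ {K = ideal K} x

    extension-by-nonunit : ¬ UnitMod I a → ProperDecIdealAbove
    extension-by-nonunit {a = a} nonunit = record
      { ideal   = I +⟨ a ⟩
      ; member? = +⟨⟩-mem? a
      ; above   = ⊆-+⟨⟩ {J = I}
      ; proper  = nonunit ∘ 1∈+⟨⟩⇒UnitMod {J = I}
      }

    opaque
      prime-divisor-∋ : ¬ UnitMod I a → ∃ λ P → IsPrimeDivisor I P × mem P a
      prime-divisor-∋ {a = a} nonunit
        with P , P-divisor , I+a⊆P ← prime-above (length residues) (extension-by-nonunit nonunit) (ℕ.m≤n+m _ _)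
        = P , P-divisor , I+a⊆P a (∈-+⟨⟩ {J = I})

    dominates-by-adjacency : (∀ x → ¬ ¬ Any (Adj I x) D) → Dominates I D
    dominates-by-adjacency {D = D} has-neighbour x =
      inj₂ (decidable-stable (any? (λ d → UnitMod? (x - d)) D) (has-neighbour x))

    record DistinctPrimeDivisors (k : ℕ) : Set (Level.suc (c ⊔ ℓ)) where
      field
        prime    : Fin k → Ideal
        divisor  : ∀ i → IsPrimeDivisor I (prime i)
        distinct : ∀ {i j} → i ≢ j → ¬ SameIdeal (prime i) (prime j)
    open DistinctPrimeDivisors

    non-neighbour⇒DistinctPrimeDivisors : (f : Fin k → Carrier) → (∀ {i j} → i ≢ j → Adj I (f i) (f j)) →
                                          (∀ i → ¬ Adj I x (f i)) → DistinctPrimeDivisors k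
    non-neighbour⇒DistinctPrimeDivisors {x = x} f adjacent non-adjacent = record
      { prime = proj₁ ∘ containing ; divisor = proj₁ ∘ proj₂ ∘ containing ; distinct = distinct′ }
      where
      containing : ∀ i → ∃ λ P → IsPrimeDivisor I P × mem P (x - f i)
      containing i = prime-divisor-∋ (non-adjacent i)
      distinct′ : ∀ {i j} → i ≢ j → ¬ SameIdeal (proj₁ (containing i)) (proj₁ (containing j))
      distinct′ {i} {j} i≢j with containing i | containing j
      ... | Pᵢ , _ , x-fᵢ∈Pᵢ | Pⱼ , Pⱼ-divisor , x-fⱼ∈Pⱼ = λ (Pᵢ⊆Pⱼ , _) →
        ∈-prime-divisor⇒¬UnitMod {J = I} {P = Pⱼ} Pⱼ-divisor
          (resp Pⱼ (solve 3 (λ x a b → (x :- b) :- (x :- a) := a :- b) refl x (f i) (f j))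
            (+-mem Pⱼ x-fⱼ∈Pⱼ (-‿mem Pⱼ (Pᵢ⊆Pⱼ _ x-fᵢ∈Pᵢ))))
          (adjacent i≢j)

    module PrimeDivisorsMaximal (maximal : ∀ {P} → IsPrimeDivisor I P → IsMaximalIdeal P) where

      comaximal : (Ps : DistinctPrimeDivisors k) → ∀ {i j} → i ≢ j → Comaximal (prime Ps i) (prime Ps j)
      comaximal Ps {i} {j} i≢j =
        distinct-maximal⇒comaximal {P = prime Ps i} {Q = prime Ps j}
          (maximal {prime Ps i} (divisor Ps i)) (maximal {prime Ps j} (divisor Ps j)) (distinct Ps i≢j)

      clique-≤-primes⇒¬Dominates : IsClique I (d₀ ∷ d₁ ∷ ds) → DistinctPrimeDivisors k →
                                   length (d₀ ∷ d₁ ∷ ds) ≤ k → ¬ Dominates I (d₀ ∷ d₁ ∷ ds)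
      clique-≤-primes⇒¬Dominates {d₀ = d₀} {d₁ = d₁} {ds = ds} clique Ps D≤k dominates =
        y-non-adjacent (Any.index y-neighbour) (lookup-index y-neighbour)
        where
        vertices = d₀ ∷ d₁ ∷ ds
        index : Fin (length vertices) → Fin _
        index i = inject≤ i D≤k
        crt = chinese-remainder (prime Ps ∘ index) (λ i≢j → comaximal Ps (i≢j ∘ inject≤-injective _ _ _ _))
                (lookup vertices)
        y = proj₁ crt
        y-non-adjacent : ∀ i → ¬ Adj I y (lookup vertices i)
        y-non-adjacent i =
          ∈-prime-divisor⇒¬UnitMod {J = I} {P = prime Ps (index i)} (divisor Ps (index i)) (proj₂ crt i)
        y-neighbour : Any (Adj I y) vertices
        y-neighbour = [ clique-neighbour {J = I} clique , id ]′ (dominates y)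

      equal-length-clique-dominates : ∀ {D₀ D} → IsDominatingClique I D₀ → IsClique I D →
                                      length D ≡ length D₀ → Dominates I D
      equal-length-clique-dominates {[]} (_ , dominates₀) _ _ = contradiction dominates₀ (¬Dominates-[] {J = I})
      equal-length-clique-dominates {_ ∷ []} {d ∷ []} (_ , dominates₀) _ _ =
        ZeroOrUnitMod⇒singleton-dominates {J = I} (singleton-dominates⇒ZeroOrUnitMod {J = I} dominates₀) d
      equal-length-clique-dominates {_ ∷ _ ∷ _} {D} (clique₀ , dominates₀) clique D≡D₀ =
        dominates-by-adjacency λ x no-neighbour →
          clique-≤-primes⇒¬Dominates clique₀
            (non-neighbour⇒DistinctPrimeDivisors (lookup D) (clique-lookup {J = I} clique)
              (λ i adj → no-neighbour (lose (∈-lookup i) adj)))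
            (≤-reflexive (≡.sym D≡D₀)) dominates₀

      ListsPrimeDivisors : List Ideal → Set (Level.suc (c ⊔ ℓ))
      ListsPrimeDivisors Ps = AllPairs (λ P Q → ¬ SameIdeal P Q) Ps × All (IsPrimeDivisor I) Ps
                            × (∀ P → IsPrimeDivisor I P → Any (SameIdeal P) Ps)

      module PrimeDivisorListing (Ps : List Ideal) (listing : ListsPrimeDivisors Ps) where

        listed : DistinctPrimeDivisors (length Ps)
        listed = record
          { prime    = lookup Ps
          ; divisor  = λ i → All.lookup (proj₁ (proj₂ listing)) (∈-lookup i)
          ; distinct = AllPairs-lookup (λ {P} {Q} P≠Q → P≠Q ∘ SameIdeal-sym {J = Q} {K = P}) (proj₁ listing)
          }

        listed-index : IsPrimeDivisor I P → Fin (length Ps)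
        listed-index {P = P} P-divisor = Any.index (proj₂ (proj₂ listing) P P-divisor)

        same-as-listed : (P-divisor : IsPrimeDivisor I P) → SameIdeal P (lookup Ps (listed-index P-divisor))
        same-as-listed {P = P} P-divisor = lookup-index (proj₂ (proj₂ listing) P P-divisor)

        λ-bound : DistinctPrimeDivisors k → k ≤ length Ps
        λ-bound Qs = ≢-preserving⇒≤ λ {i} {j} i≢j same-index → distinct Qs i≢j
          (SameIdeal-trans {J = prime Qs i} {K = lookup Ps (index i)} {P = prime Qs j} (same i)
            (≡.subst (λ s → SameIdeal (lookup Ps s) (prime Qs j)) (≡.sym same-index)
              (SameIdeal-sym {J = prime Qs j} {K = lookup Ps (index j)} (same j))))
          where
          index : ∀ i → Fin (length Ps)
          index i = listed-index {P = prime Qs i} (divisor Qs i)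
          same : ∀ i → SameIdeal (prime Qs i) (lookup Ps (index i))
          same i = same-as-listed {P = prime Qs i} (divisor Qs i)

        nonunit⇒∈-listed : ¬ UnitMod I a → ∃ λ i → mem (lookup Ps i) a
        nonunit⇒∈-listed nonunit with P , P-divisor , a∈P ← prime-divisor-∋ nonunit =
          listed-index {P = P} P-divisor , proj₁ (same-as-listed {P = P} P-divisor) _ a∈P

        incongruent-mod-listed⇒Adj : (∀ i → ¬ a ≡[ lookup Ps i ] b) → Adj I a b
        incongruent-mod-listed⇒Adj incongruent =
          decidable-stable (UnitMod? _) (uncurry incongruent ∘ nonunit⇒∈-listed)

        listed-mem? : ∀ i x → Dec (mem (lookup Ps i) x)
        listed-mem? i x = map′ nonunit⇒x∈Pᵢ x∈Pᵢ⇒nonunit (¬? (UnitMod? y))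
          where
          -- y ≡ x modulo Pᵢ and y ≡ 1 modulo the other listed primes, so y is a non-unit iff x ∈ Pᵢ.
          target : Fin (length Ps) → Carrier
          target j with i ≟ j
          ... | yes _ = x
          ... | no  _ = 1#
          crt = chinese-remainder (lookup Ps) (comaximal listed) target
          y = proj₁ crt
          y≡x : y ≡[ lookup Ps i ] x
          y≡x with i ≟ i | proj₂ crt i
          ... | yes _  | y≡t = y≡t
          ... | no i≢i | _   = contradiction ≡.refl i≢i
          y≡1 : ∀ {j} → i ≢ j → y ≡[ lookup Ps j ] 1#
          y≡1 {j} i≢j with i ≟ j | proj₂ crt j
          ... | yes i≡j | _   = contradiction i≡j i≢j
          ... | no _    | y≡t = y≡t
          x∈Pᵢ⇒nonunit : mem (lookup Ps i) x → ¬ UnitMod I y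
          x∈Pᵢ⇒nonunit x∈Pᵢ = ∈-prime-divisor⇒¬UnitMod {J = I} {P = lookup Ps i} (divisor listed i)
                                 (∈-resp-≡[] (lookup Ps i) y≡x x∈Pᵢ)
          nonunit⇒x∈Pᵢ : ¬ UnitMod I y → mem (lookup Ps i) x
          nonunit⇒x∈Pᵢ nonunit with j , y∈Pⱼ ← nonunit⇒∈-listed nonunit with i ≟ j
          ... | yes ≡.refl = ∈-resp-≡[] (lookup Ps i) (≡[]-sym (lookup Ps i) y≡x) y∈Pⱼ
          ... | no i≢j     = contradiction (∈-resp-≡[] (lookup Ps j) (≡[]-sym (lookup Ps j) (y≡1 i≢j)) y∈Pⱼ)
                                           (proj₁ (proj₁ (divisor listed j)))

        listed-size : ∀ i → ∃ λ n → HasSize (lookup Ps i) n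
        listed-size i = HasSize-above {P = lookup Ps i} (proj₂ (divisor listed i)) (listed-mem? i)

        λ<dominating-clique-length : ¬ IsPrimeIdeal I → ∀ {D} → IsDominatingClique I D → length Ps < length D
        λ<dominating-clique-length _ {[]} (_ , dominates) = contradiction dominates (¬Dominates-[] {J = I})
        λ<dominating-clique-length ¬prime {_ ∷ []} (_ , dominates) =
          contradiction (ZeroOrUnitMod⇒prime {J = I} I-proper (singleton-dominates⇒ZeroOrUnitMod {J = I} dominates))
                        ¬prime
        λ<dominating-clique-length _ {_ ∷ _ ∷ _} (clique , dominates) =
          ≰⇒> λ D≤λ → clique-≤-primes⇒¬Dominates clique listed D≤λ dominates

        no-dominating-clique-if-Q≤λ : ¬ IsPrimeIdeal I → Qval I n → n ≤ length Ps → ¬ GammaClExists I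
        no-dominating-clique-if-Q≤λ ¬prime ((P₀ , P₀-divisor , P₀-size) , _) Q≤λ (D , clique , dominates) =
          <⇒≱ (λ<dominating-clique-length ¬prime (clique , dominates))
              (≤-trans (clique-length-≤ {J = I} {P = P₀} P₀-divisor P₀-size clique) Q≤λ)

        γcl-of-λ<Q : ¬ IsPrimeIdeal I → Qval I n → length Ps < n → GammaCl I (suc (length Ps))
        γcl-of-λ<Q ¬prime (_ , Q-minimal) λ<Q =
          (tabulate y , (clique , dominates) , length-tabulate y) , λ _ → λ<dominating-clique-length ¬prime
          where
          N = suc (length Ps)
          separated-residues : ∀ i → Σ (Fin N → Carrier) λ r → ∀ {j k} → j ≢ k → ¬ r j ≡[ lookup Ps i ] r k
          separated-residues i = incongruent-family {P = lookup Ps i} (proj₂ (listed-size i))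
            (≤-trans λ<Q (Q-minimal (lookup Ps i) _ (divisor listed i) (proj₂ (listed-size i))))
          r : Fin (length Ps) → Fin N → Carrier
          r i = proj₁ (separated-residues i)
          crt : ∀ j → ∃ λ y → ∀ i → y ≡[ lookup Ps i ] r i j
          crt j = chinese-remainder (lookup Ps) (comaximal listed) (λ i → r i j)
          y : Fin N → Carrier
          y j = proj₁ (crt j)
          y-adjacent : ∀ {j k} → j ≢ k → Adj I (y j) (y k)
          y-adjacent {j} {k} j≢k = incongruent-mod-listed⇒Adj λ i yⱼ≡yₖ → proj₂ (separated-residues i) j≢k
            (≡[]-trans (lookup Ps i) (≡[]-sym (lookup Ps i) (proj₂ (crt j) i))
              (≡[]-trans (lookup Ps i) yⱼ≡yₖ (proj₂ (crt k) i)))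
          clique : IsClique I (tabulate y)
          clique = AllPairs.tabulate⁺ λ j≢k → Adj⇒≢ {J = I} I-proper (y-adjacent j≢k) , y-adjacent j≢k
          dominates : Dominates I (tabulate y)
          dominates = dominates-by-adjacency λ x no-neighbour → ℕ.1+n≰n (λ-bound
            (non-neighbour⇒DistinctPrimeDivisors {x = x} y y-adjacent
              λ j adj → no-neighbour (Any.tabulate⁺ {f = y} j adj)))

open import Data.Nat.Base using (_+_)

theorem4p5 : {c ℓ : Level} (R : CommutativeRing c ℓ) →
    let open RingTheory R in
    IsDedekindDomain → (I : Ideal) → NonzeroIdeal I →
    (∃ λ n → HasSize I n) → Proper I →
    (IsPrimeIdeal I → GammaCl I 1)
    × (∀ q m → ¬ IsPrimeIdeal I → Qval I q → Lambda I m → m < q → GammaCl I (m + 1))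
    × (∀ q m → ¬ IsPrimeIdeal I → Qval I q → Lambda I m → q ≤ m → ¬ GammaClExists I)
    × (∀ k → GammaCl I k → ∀ D → IsClique I D → length D ≡ k → Dominates I D)
theorem4p5 R dedekind I I≢0 (_ , residues , _ , residues-distinct , residues-cover) I-proper =
    (λ I-prime → γcl-of-maximal {J = I} (maximal {I} (I-prime , λ _ → id)))
  , (λ q m ¬prime Q-is-q (Ps , λ≡m , listing) λ<Q →
       ≡.subst (GammaCl I) (≡.trans (≡.cong suc λ≡m) (ℕ.+-comm 1 m))
         (γcl-of-λ<Q Ps listing ¬prime Q-is-q (≡.subst (_< q) (≡.sym λ≡m) λ<Q)))
  , (λ q m ¬prime Q-is-q (Ps , λ≡m , listing) Q≤λ →
       no-dominating-clique-if-Q≤λ Ps listing ¬prime Q-is-q (≡.subst (q ≤_) (≡.sym λ≡m) Q≤λ))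
  , λ k ((D₀ , D₀-dominating , D₀≡k) , _) D clique D≡k →
       equal-length-clique-dominates D₀-dominating clique (≡.trans D≡k (≡.sym D₀≡k))
  where
  open RingTheory R
  open IdealTheory R
  open FiniteQuotient I I-proper residues residues-distinct residues-cover
  maximal : ∀ {P} → IsPrimeDivisor I P → IsMaximalIdeal P
  maximal {P} = prime-divisor-maximal {J = I} {P = P} dedekind I≢0
  open PrimeDivisorsMaximal (λ {P} → maximal {P})
  open PrimeDivisorListing
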